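{- Let $p\in\mathbb{Z}$ be prime. Suppose $f(x)\in\mathbb{Z}_{(p)}[x]$ and $a\in\mathbb{Z}_{(p)}$. If $v_p(f^m(0)-a)>0$ and $v_p(f^n(0)-a)>0$ for some integers $m,n\ge1$ with $m\ne n$, then $v_p(f^\ell(a)-a)>0$ for some $\ell\ge1$.
   Context: $\mathbb{Z}_{(p)}$ is the localization of $\mathbb{Z}$ at the prime ideal $(p)$; $v_p$ is the $p$-adic valuation, with $v_p(0)=\infty$; $f^n$ denotes the $n$-th iterate of $f$. -}

module Defs where

open import Data.Nat using (ℕ; zero; suc)
open import Data.Nat.Divisibility using (_∣_)
open import Data.Integer using (∣_∣)
open import Data.Rational using (ℚ; 0ℚ; _+_; _*_)
open import Data.List using (List; []; _∷_)
open import Data.List.Relation.Unary.All using (All)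
open import Relation.Nullary using (¬_)

InZp : ℕ → ℚ → Set
InZp p q = ¬ (p ∣ ℚ.denominatorℕ q)

-- v_p(q) > 0 (with v_p(0) = ∞): since q is stored in lowest terms,
-- v_p(q) > 0 iff p divides the numerator (numerator 0 covers q = 0)
VpPos : ℕ → ℚ → Set
VpPos p q = p ∣ ∣ ℚ.numerator q ∣

-- polynomials as coefficient lists [c₀, c₁, …, c_d], evaluated by Horner
Poly : Set
Poly = List ℚ

eval : Poly → ℚ → ℚ
eval [] x = 0ℚ
eval (c ∷ cs) x = c + x * eval cs x

PolyZp : ℕ → Poly → Set
PolyZp p f = All (InZp p) f

iter : Poly → ℕ → ℚ → ℚ
iter f zero x = x
iter f (suc n) x = eval f (iter f n x)

{-# OPTIONS --safe #-}
-- Reduction modulo p is a ring homomorphism on ℤ_(p), so for f ∈ ℤ_(p)[x] congruence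
-- mod p is preserved by f. If f^m(0) ≡ a ≡ f^n(0) with m < n, then
-- f^(n-m)(a) ≡ f^(n-m)(f^m(0)) = f^n(0) ≡ a.
-- Congruence is handled on unnormalised fractions, where x ≡ y iff p divides
-- ↥x·↧y − ↥y·↧x, and transported to ℚ along toℚᵘ.
module Submission where

open import Defs
open import Data.Nat using (ℕ; _≥_)
open import Data.Nat.Primality using (Prime)
open import Data.Rational using (ℚ; 0ℚ; _-_)
open import Data.Product using (Σ; _×_)
open import Relation.Binary.PropositionalEquality using (_≢_)

import Data.Nat as ℕ
import Data.Nat.Properties as ℕ
import Data.Nat.Divisibility as ℕ
open import Data.Nat.Primality using (euclidsLemma; ¬prime[1])
open import Data.Nat.Coprimality using (recompute)
open import Data.Integer as ℤ using (ℤ; +_; +0)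
import Data.Integer.Properties as ℤ
open import Data.Integer.Divisibility.Signed using (_∣_; ∣ᵤ⇒∣; ∣⇒∣ᵤ; ∣m∣n⇒∣m+n; ∣n⇒∣m*n; ∣m⇒∣-m)
open import Data.Integer.Solver using (module +-*-Solver)
open import Data.Rational as ℚ using (mkℚ; toℚᵘ; -_; _+_; _*_)
import Data.Rational.Properties as ℚ
open import Data.Rational.Unnormalised as ℚᵘ using (ℚᵘ; mkℚᵘ; _≃_; *≡*; ↥_; ↧_; ↧ₙ_)
open import Data.Rational.Unnormalised.Properties using (≃-refl)
open import Data.List using ([]; _∷_)
open import Data.List.Relation.Unary.All using ([]; _∷_)
open import Data.Product using (_,_)
open import Data.Sum as Sum using (_⊎_; [_,_]′)
open import Data.Empty using (⊥-elim)
open import Relation.Binary.Definitions using (tri<; tri≈; tri>)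
open import Relation.Nullary using (¬_)
open import Function using (id)
open import Relation.Binary.Bundles using (PartialSetoid)
import Relation.Binary.Reasoning.PartialSetoid as ≈-Reasoning
open import Relation.Binary.PropositionalEquality
  using (_≡_; refl; sym; cong; subst; subst₂; module ≡-Reasoning)

iter-+ : ∀ f k m x → iter f (k ℕ.+ m) x ≡ iter f k (iter f m x)
iter-+ f ℕ.zero    m x = refl
iter-+ f (ℕ.suc k) m x = cong (eval f) (iter-+ f k m x)

cross : ℚᵘ → ℚᵘ → ℤ
cross x y = ↥ x ℤ.* ↧ y ℤ.- ↥ y ℤ.* ↧ x

module _ where
  open +-*-Solver

  cross-sym : ∀ x y → cross y x ≡ ℤ.- cross x y
  cross-sym (mkℚᵘ a b) (mkℚᵘ c d) =
    solve 4 (λ a b c d → c :* b :- a :* d := :- (a :* d :- c :* b)) refl a (+ ℕ.suc b) c (+ ℕ.suc d)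

  cross-trans : ∀ x y z → ↧ y ℤ.* cross x z ≡ ↧ z ℤ.* cross x y ℤ.+ ↧ x ℤ.* cross y z
  cross-trans (mkℚᵘ a b) (mkℚᵘ c d) (mkℚᵘ e f) =
    solve 6 (λ a b c d e f →
      d :* (a :* f :- e :* b) := f :* (a :* d :- c :* b) :+ b :* (c :* f :- e :* d))
      refl a (+ ℕ.suc b) c (+ ℕ.suc d) e (+ ℕ.suc f)

  cross-+ : ∀ x₁ x₂ y₁ y₂ →
    cross (x₁ ℚᵘ.+ x₂) (y₁ ℚᵘ.+ y₂)
      ≡ (↧ x₂ ℤ.* ↧ y₂) ℤ.* cross x₁ y₁ ℤ.+ (↧ x₁ ℤ.* ↧ y₁) ℤ.* cross x₂ y₂
  cross-+ (mkℚᵘ a b) (mkℚᵘ c d) (mkℚᵘ e f) (mkℚᵘ g h) =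
    solve 8 (λ a b c d e f g h →
      (a :* d :+ c :* b) :* (f :* h) :- (e :* h :+ g :* f) :* (b :* d)
      := (d :* h) :* (a :* f :- e :* b) :+ (b :* f) :* (c :* h :- g :* d))
      refl a (+ ℕ.suc b) c (+ ℕ.suc d) e (+ ℕ.suc f) g (+ ℕ.suc h)

  cross-* : ∀ x₁ x₂ y₁ y₂ →
    cross (x₁ ℚᵘ.* x₂) (y₁ ℚᵘ.* y₂)
      ≡ (↥ x₂ ℤ.* ↧ y₂) ℤ.* cross x₁ y₁ ℤ.+ (↥ y₁ ℤ.* ↧ x₁) ℤ.* cross x₂ y₂
  cross-* (mkℚᵘ a b) (mkℚᵘ c d) (mkℚᵘ e f) (mkℚᵘ g h) =
    solve 8 (λ a b c d e f g h →
      (a :* c) :* (f :* h) :- (e :* g) :* (b :* d)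
      := (c :* h) :* (a :* f :- e :* b) :+ (e :* b) :* (c :* h :- g :* d))
      refl a (+ ℕ.suc b) c (+ ℕ.suc d) e (+ ℕ.suc f) g (+ ℕ.suc h)

  cross-0 : ∀ x → cross x ℚᵘ.0ℚᵘ ≡ ↥ x
  cross-0 (mkℚᵘ a b) = solve 2 (λ a b → a :* con (+ 1) :- con (+ 0) :* b := a) refl a (+ ℕ.suc b)

≃⇒cross≡0 : ∀ {x y} → x ≃ y → cross x y ≡ + 0
≃⇒cross≡0 {x} {y} (*≡* eq) rewrite eq = ℤ.+-inverseʳ (↥ y ℤ.* ↧ x)

module Congruence {p : ℕ} (p-prime : Prime p) where

  p≢1 : p ≢ 1
  p≢1 refl = ¬prime[1] p-prime

  p∤1 : ¬ p ℕ.∣ 1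
  p∤1 p∣1 = p≢1 (ℕ.∣1⇒≡1 p∣1)

  euclidsLemmaℤ : ∀ i j → + p ∣ i ℤ.* j → + p ∣ i ⊎ + p ∣ j
  euclidsLemmaℤ i j p∣i*j = Sum.map ∣ᵤ⇒∣ ∣ᵤ⇒∣
    (euclidsLemma ℤ.∣ i ∣ ℤ.∣ j ∣ p-prime (subst (p ℕ.∣_) (ℤ.abs-* i j) (∣⇒∣ᵤ p∣i*j)))

  InZpᵘ : ℚᵘ → Set
  InZpᵘ x = ¬ p ℕ.∣ ↧ₙ x

  p∤m⇒p∤n⇒p∤m*n : ∀ {m n} → ¬ p ℕ.∣ m → ¬ p ℕ.∣ n → ¬ p ℕ.∣ m ℕ.* n
  p∤m⇒p∤n⇒p∤m*n p∤m p∤n p∣m*n = [ p∤m , p∤n ]′ (euclidsLemma _ _ p-prime p∣m*n)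

  inZpᵘ-+ : ∀ {x y} → InZpᵘ x → InZpᵘ y → InZpᵘ (x ℚᵘ.+ y)
  inZpᵘ-+ {mkℚᵘ _ _} {mkℚᵘ _ _} = p∤m⇒p∤n⇒p∤m*n

  inZpᵘ-* : ∀ {x y} → InZpᵘ x → InZpᵘ y → InZpᵘ (x ℚᵘ.* y)
  inZpᵘ-* {mkℚᵘ _ _} {mkℚᵘ _ _} = p∤m⇒p∤n⇒p∤m*n

  infix 4 _≋_ _≈_

  record _≋_ (x y : ℚᵘ) : Set where
    field
      inZpˡ : InZpᵘ x
      inZpʳ : InZpᵘ y
      p∣cross : + p ∣ cross x y
  open _≋_

  ≃⇒≋ : ∀ {x y} → x ≃ y → InZpᵘ x → InZpᵘ y → x ≋ y
  ≃⇒≋ x≃y x∈ y∈ = record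
    { inZpˡ = x∈ ; inZpʳ = y∈ ; p∣cross = subst (+ p ∣_) (sym (≃⇒cross≡0 x≃y)) (∣ᵤ⇒∣ (p ℕ.∣0)) }

  ≋-refl : ∀ {x} → InZpᵘ x → x ≋ x
  ≋-refl {x} x∈ = ≃⇒≋ (≃-refl {x}) x∈ x∈

  ≋-sym : ∀ {x y} → x ≋ y → y ≋ x
  ≋-sym {x} {y} x≋y = record
    { inZpˡ = inZpʳ x≋y ; inZpʳ = inZpˡ x≋y
    ; p∣cross = subst (+ p ∣_) (sym (cross-sym x y)) (∣m⇒∣-m (p∣cross x≋y)) }

  ≋-trans : ∀ {x y z} → x ≋ y → y ≋ z → x ≋ z
  ≋-trans {x} {y} {z} x≋y y≋z = record
    { inZpˡ = inZpˡ x≋y ; inZpʳ = inZpʳ y≋z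
    ; p∣cross = [ (λ p∣↧y → ⊥-elim (inZpʳ x≋y (∣⇒∣ᵤ p∣↧y))) , id ]′
                  (euclidsLemmaℤ (↧ y) (cross x z) p∣↧y*cross) }
    where
    p∣↧y*cross : + p ∣ ↧ y ℤ.* cross x z
    p∣↧y*cross = subst (+ p ∣_) (sym (cross-trans x y z))
      (∣m∣n⇒∣m+n (∣n⇒∣m*n (↧ z) (p∣cross x≋y)) (∣n⇒∣m*n (↧ x) (p∣cross y≋z)))

  +-cong-≋ : ∀ {x₁ y₁ x₂ y₂} → x₁ ≋ y₁ → x₂ ≋ y₂ → (x₁ ℚᵘ.+ x₂) ≋ (y₁ ℚᵘ.+ y₂)
  +-cong-≋ {x₁} {y₁} {x₂} {y₂} s t = record
    { inZpˡ = inZpᵘ-+ {x₁} {x₂} (inZpˡ s) (inZpˡ t)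
    ; inZpʳ = inZpᵘ-+ {y₁} {y₂} (inZpʳ s) (inZpʳ t)
    ; p∣cross = subst (+ p ∣_) (sym (cross-+ x₁ x₂ y₁ y₂))
        (∣m∣n⇒∣m+n (∣n⇒∣m*n (↧ x₂ ℤ.* ↧ y₂) (p∣cross s)) (∣n⇒∣m*n (↧ x₁ ℤ.* ↧ y₁) (p∣cross t))) }

  *-cong-≋ : ∀ {x₁ y₁ x₂ y₂} → x₁ ≋ y₁ → x₂ ≋ y₂ → (x₁ ℚᵘ.* x₂) ≋ (y₁ ℚᵘ.* y₂)
  *-cong-≋ {x₁} {y₁} {x₂} {y₂} s t = record
    { inZpˡ = inZpᵘ-* {x₁} {x₂} (inZpˡ s) (inZpˡ t)
    ; inZpʳ = inZpᵘ-* {y₁} {y₂} (inZpʳ s) (inZpʳ t)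
    ; p∣cross = subst (+ p ∣_) (sym (cross-* x₁ x₂ y₁ y₂))
        (∣m∣n⇒∣m+n (∣n⇒∣m*n (↥ x₂ ℤ.* ↧ y₂) (p∣cross s)) (∣n⇒∣m*n (↥ y₁ ℤ.* ↧ x₁) (p∣cross t))) }

  -- q is in lowest terms, so its denominator divides that of any fraction equal to it.
  toℚᵘ-inZpᵘ : ∀ q {y} → toℚᵘ q ≃ y → InZpᵘ y → InZpᵘ (toℚᵘ q)
  toℚᵘ-inZpᵘ (mkℚ n d n⊥d) {y} (*≡* eq) y∈ p∣d =
    [ (λ p∣n → p≢1 (recompute n⊥d (∣⇒∣ᵤ p∣n , p∣d))) , (λ p∣↧y → y∈ (∣⇒∣ᵤ p∣↧y)) ]′
      (euclidsLemmaℤ n (↧ y) (subst (+ p ∣_) (sym eq) (∣n⇒∣m*n (↥ y) (∣ᵤ⇒∣ p∣d))))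

  toℚᵘ-≋ : ∀ q {y} → toℚᵘ q ≃ y → InZpᵘ y → toℚᵘ q ≋ y
  toℚᵘ-≋ q q≃y y∈ = ≃⇒≋ q≃y (toℚᵘ-inZpᵘ q q≃y y∈) y∈

  -- A record rather than a synonym, so that q and r can be inferred from q ≈ r.
  record _≈_ (q r : ℚ) : Set where
    constructor lift
    field
      lower : toℚᵘ q ≋ toℚᵘ r
  open _≈_

  ≈-sym : ∀ {q r} → q ≈ r → r ≈ q
  ≈-sym (lift q≋r) = lift (≋-sym q≋r)

  ≈-trans : ∀ {q r s} → q ≈ r → r ≈ s → q ≈ s
  ≈-trans (lift q≋r) (lift r≋s) = lift (≋-trans q≋r r≋s)

  ≈-partialSetoid : PartialSetoid _ _
  ≈-partialSetoid = record
    { Carrier = ℚ ; _≈_ = _≈_ ; isPartialEquivalence = record { sym = ≈-sym ; trans = ≈-trans } }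

  ≈-refl : ∀ q → InZp p q → q ≈ q
  ≈-refl (mkℚ _ _ _) q∈ = lift (≋-refl q∈)

  inZpᵘ-neg : ∀ {r} → InZpᵘ (toℚᵘ r) → InZpᵘ (toℚᵘ (- r))
  inZpᵘ-neg {mkℚ +0         _ _} r∈ = r∈
  inZpᵘ-neg {mkℚ ℤ.+[1+ _ ] _ _} r∈ = r∈
  inZpᵘ-neg {mkℚ ℤ.-[1+ _ ] _ _} r∈ = r∈

  homo-cong-≈ : {_∙_ : ℚ → ℚ → ℚ} {_∘_ : ℚᵘ → ℚᵘ → ℚᵘ} →
    (∀ q r → toℚᵘ (q ∙ r) ≃ toℚᵘ q ∘ toℚᵘ r) →
    (∀ {x₁ y₁ x₂ y₂} → x₁ ≋ y₁ → x₂ ≋ y₂ → (x₁ ∘ x₂) ≋ (y₁ ∘ y₂)) →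
    ∀ {q₁ r₁ q₂ r₂} → q₁ ≈ r₁ → q₂ ≈ r₂ → (q₁ ∙ q₂) ≈ (r₁ ∙ r₂)
  homo-cong-≈ {_∘_ = _∘_} homo ∘-cong {q₁} {r₁} {q₂} {r₂} (lift s) (lift t) =
    lift (≋-trans (toℚᵘ-≋ _ (homo q₁ q₂) (inZpˡ u))
           (≋-trans u (≋-sym (toℚᵘ-≋ _ (homo r₁ r₂) (inZpʳ u)))))
    where
    u : (toℚᵘ q₁ ∘ toℚᵘ q₂) ≋ (toℚᵘ r₁ ∘ toℚᵘ r₂)
    u = ∘-cong s t

  +-cong-≈ : ∀ {q₁ r₁ q₂ r₂} → q₁ ≈ r₁ → q₂ ≈ r₂ → (q₁ + q₂) ≈ (r₁ + r₂)
  +-cong-≈ = homo-cong-≈ ℚ.toℚᵘ-homo-+ +-cong-≋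

  *-cong-≈ : ∀ {q₁ r₁ q₂ r₂} → q₁ ≈ r₁ → q₂ ≈ r₂ → (q₁ * q₂) ≈ (r₁ * r₂)
  *-cong-≈ = homo-cong-≈ ℚ.toℚᵘ-homo-* *-cong-≋

  eval-cong : ∀ {f} → PolyZp p f → ∀ {q r} → q ≈ r → eval f q ≈ eval f r
  eval-cong {[]}    []         q≈r = ≈-refl 0ℚ p∤1
  eval-cong {c ∷ _} (c∈ ∷ cs∈) q≈r = +-cong-≈ (≈-refl c c∈) (*-cong-≈ q≈r (eval-cong cs∈ q≈r))

  iter-cong : ∀ {f} → PolyZp p f → ∀ k {q r} → q ≈ r → iter f k q ≈ iter f k r
  iter-cong f∈ ℕ.zero    q≈r = q≈r
  iter-cong f∈ (ℕ.suc k) q≈r = eval-cong f∈ (iter-cong f∈ k q≈r)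

  VpPos⇒InZp : ∀ {q} → VpPos p q → InZp p q
  VpPos⇒InZp {mkℚ n d n⊥d} p∣n p∣d = p≢1 (recompute n⊥d (p∣n , p∣d))

  VpPos⇒≈0ℚ : ∀ {q} → VpPos p q → q ≈ 0ℚ
  VpPos⇒≈0ℚ {q@(mkℚ _ _ _)} p∣n = lift record
    { inZpˡ = VpPos⇒InZp {q} p∣n ; inZpʳ = p∤1
    ; p∣cross = subst (+ p ∣_) (sym (cross-0 (toℚᵘ q))) (∣ᵤ⇒∣ p∣n) }

  ≈0ℚ⇒VpPos : ∀ {q} → q ≈ 0ℚ → VpPos p q
  ≈0ℚ⇒VpPos {q@(mkℚ _ _ _)} q≈0 = ∣⇒∣ᵤ (subst (+ p ∣_) (cross-0 (toℚᵘ q)) (p∣cross (lower q≈0)))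

  VpPos-diff⇒≈ : ∀ {q r} → InZp p r → VpPos p (q - r) → q ≈ r
  VpPos-diff⇒≈ {q} {r} r∈ v =
    subst₂ _≈_ q-r+r≡q (ℚ.+-identityˡ r) (+-cong-≈ (VpPos⇒≈0ℚ {q - r} v) (≈-refl r r∈))
    where
    open ≡-Reasoning
    q-r+r≡q : q - r + r ≡ q
    q-r+r≡q = begin
      q - r + r     ≡⟨ ℚ.+-assoc q (- r) r ⟩
      q + (- r + r) ≡⟨ cong (_+_ q) (ℚ.+-inverseˡ r) ⟩
      q + 0ℚ        ≡⟨ ℚ.+-identityʳ q ⟩
      q             ∎

  ≈⇒VpPos-diff : ∀ {q r} → q ≈ r → VpPos p (q - r)
  ≈⇒VpPos-diff {q} {r} q≈r =
    ≈0ℚ⇒VpPos (subst ((q - r) ≈_) (ℚ.+-inverseʳ r) (+-cong-≈ q≈r -r≈-r))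
    where
    -r≈-r : - r ≈ - r
    -r≈-r = lift (≋-refl (inZpᵘ-neg {r} (inZpʳ (lower q≈r))))

  iter-return : ∀ {f} → PolyZp p f → ∀ {a} → InZp p a → ∀ {m n x} → m ℕ.< n →
    VpPos p (iter f m x - a) → VpPos p (iter f n x - a) → VpPos p (iter f (n ℕ.∸ m) a - a)
  iter-return {f} f∈ {a} a∈ {m} {n} {x} m<n hm hn = ≈⇒VpPos-diff (begin
    iter f (n ℕ.∸ m) a               ≈⟨ iter-cong f∈ (n ℕ.∸ m) (VpPos-diff⇒≈ a∈ hm) ⟨
    iter f (n ℕ.∸ m) (iter f m x)    ≡⟨ iter-+ f (n ℕ.∸ m) m x ⟨
    iter f (n ℕ.∸ m ℕ.+ m) x         ≡⟨ cong (λ k → iter f k x) (ℕ.m∸n+n≡m (ℕ.<⇒≤ m<n)) ⟩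
    iter f n x                       ≈⟨ VpPos-diff⇒≈ a∈ hn ⟩
    a                                ∎)
    where open ≈-Reasoning ≈-partialSetoid

  recurrent-mod-p : ∀ {f} → PolyZp p f → ∀ {a} → InZp p a → ∀ {x m n} → m ≢ n →
    VpPos p (iter f m x - a) → VpPos p (iter f n x - a) →
    Σ ℕ (λ ℓ → ℓ ≥ 1 × VpPos p (iter f ℓ a - a))
  recurrent-mod-p f∈ a∈ {m = m} {n = n} m≢n hm hn with ℕ.<-cmp m n
  ... | tri< m<n _ _ = n ℕ.∸ m , ℕ.m<n⇒0<n∸m m<n , iter-return f∈ a∈ m<n hm hn
  ... | tri≈ _ m≡n _ = ⊥-elim (m≢n m≡n)
  ... | tri> _ _ n<m = m ℕ.∸ n , ℕ.m<n⇒0<n∸m n<m , iter-return f∈ a∈ n<m hn hm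

lemma3p1 : (p : ℕ) → Prime p → (f : Poly) → PolyZp p f → (a : ℚ) → InZp p a →
    (m n : ℕ) → m ≥ 1 → n ≥ 1 → m ≢ n →
    VpPos p (iter f m 0ℚ - a) → VpPos p (iter f n 0ℚ - a) →
    Σ ℕ (λ ℓ → ℓ ≥ 1 × VpPos p (iter f ℓ a - a))
lemma3p1 p p-prime f f∈ a a∈ m n _ _ m≢n = recurrent-mod-p f∈ a∈ m≢n
  where open Congruence p-prime
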